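{- Let $G=(V,E)$ be a finite simple graph with $n=|V|$, and let $C\subseteq V$. Let $x\in\{0,1\}^V$ and $F=\{v\in V: x_v=1\}$. Then $F$ is a fort of $G$ and $F\subseteq V\setminus\operatorname{cl}(C)$ if and only if the following hold: (1) $\sum_{v\in V}x_v\ge 1$; (2) $x_u-x_v+\sum_{w\in N(u)\setminus\{v\}}x_w\ge 0$ for all $v\in V$ and $u\in N(v)$; (3) $x_v=0$ for all $v\in C$.
   Context: $N(u)$ is the neighborhood of $u$. A fort of $G$ is a non-empty set $F\subseteq V$ such that no vertex $u\in V\setminus F$ has exactly one neighbor in $F$. Standard zero forcing rule: a filled vertex $u$ forces a non-filled vertex $v$ if $v$ is the only non-filled neighbor of $u$; the closure $\operatorname{cl}(C)$ is the set of filled vertices obtained by starting with $C$ filled and applying the rule until no more forces are possible. -}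

module Defs where

open import Data.Nat using (ℕ; zero; suc)
open import Data.Fin using (Fin; zero; suc)
open import Data.Fin.Subset using (Subset; _∈_; _∉_)
open import Data.Bool using (Bool; true; false; if_then_else_; _∧_; not)
open import Data.Integer using (ℤ; _+_; _-_; 0ℤ; 1ℤ; _≥_)
open import Data.Product using (∃; _×_)
open import Relation.Binary.PropositionalEquality using (_≡_; _≢_)
open import Relation.Nullary using (¬_; does)
open import Data.Fin using (_≟_)

record SimpleGraph (n : ℕ) : Set where
  field
    adj       : Fin n → Fin n → Bool
    adj-sym   : ∀ u v → adj u v ≡ adj v u
    adj-irrefl : ∀ v → adj v v ≡ false
open SimpleGraph public

Adj : ∀ {n} → SimpleGraph n → Fin n → Fin n → Set
Adj G u w = adj G u w ≡ true

Σ : ∀ {n} → (Fin n → ℤ) → ℤ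
Σ {zero} f = 0ℤ
Σ {suc n} f = f zero + Σ (λ i → f (suc i))

⟦_⟧ : Bool → ℤ
⟦ true ⟧ = 1ℤ
⟦ false ⟧ = 0ℤ

InF : ∀ {n} → (Fin n → Bool) → Fin n → Set
InF x v = x v ≡ true

ExactlyOneNbrIn : ∀ {n} → SimpleGraph n → (Fin n → Bool) → Fin n → Set
ExactlyOneNbrIn G x u =
  ∃ λ w → Adj G u w × InF x w × (∀ w' → Adj G u w' → InF x w' → w' ≡ w)

IsFort : ∀ {n} → SimpleGraph n → (Fin n → Bool) → Set
IsFort G x =
  (∃ λ v → InF x v) ×
  (∀ u → ¬ InF x u → ¬ ExactlyOneNbrIn G x u)

-- Zero forcing closure cl(C): the set of vertices filled by repeatedly
-- applying the rule "a filled u forces v if v is the only non-filled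
-- neighbour of u", starting from C. Defined as the least set containing C
-- and closed under the forcing rule.
data InClosure {n : ℕ} (G : SimpleGraph n) (C : Subset n) : Fin n → Set where
  base  : ∀ {v} → v ∈ C → InClosure G C v
  force : ∀ {u v} → InClosure G C u → Adj G u v →
          (∀ w → Adj G u w → w ≢ v → InClosure G C w) →
          InClosure G C v

nbrSumExcept : ∀ {n} → SimpleGraph n → (Fin n → Bool) → Fin n → Fin n → ℤ
nbrSumExcept G x u v =
  Σ (λ w → if adj G u w ∧ not (does (w ≟ v)) then ⟦ x w ⟧ else 0ℤ)

{-# OPTIONS --safe #-}
module Submission where

-- Constraint (2) at an edge vu can only fail when x u = 0, x v = 1 and no other
-- neighbour of u lies in F, i.e. when u ∉ F has v as its unique neighbour in F;
-- so (1) and (2) together say exactly that F is a fort.  A fort disjoint from C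
-- stays disjoint from cl(C): a filled u ∉ F forcing v ∈ F has all its other
-- neighbours filled, hence outside F, so v would be its unique neighbour in F.

open import Defs
open import Data.Nat using (ℕ; zero; suc; z≤n)
open import Data.Fin using (Fin; zero; suc; _≟_)
open import Data.Fin.Subset using (Subset; _∈_)
open import Data.Bool using (Bool; true; false; _∧_; not; if_then_else_)
open import Data.Bool.Properties using (¬-not; not-¬)
open import Data.Integer using (ℤ; +≤+; _+_; _-_; 0ℤ; 1ℤ; _≤_; _≥_; _≤?_)
open import Data.Integer.Properties
  using (≤-refl; +-identityˡ; +-mono-≤; +-monoʳ-≤;
         i≤pred[j]⇒i<j; i<j⇒i≤pred[j]; i<j⇒suc[i]≤j; suc[i]≤j⇒i<j)
open import Data.Product using (∃; _×_; _,_; proj₂)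
open import Function using (_∘_)
open import Function.Bundles using (_⇔_; mk⇔; Equivalence)
open import Relation.Binary.PropositionalEquality
  using (_≡_; _≢_; refl; sym; trans; cong₂; subst)
open import Relation.Nullary using (¬_; Dec; yes; no; does; contradiction)
open import Relation.Nullary.Decidable using (decidable-stable)
import Relation.Nullary.Decidable as Dec

open Equivalence using (to; from)

⟦⟧-nonneg : ∀ b → 0ℤ ≤ ⟦ b ⟧
⟦⟧-nonneg true  = +≤+ z≤n
⟦⟧-nonneg false = +≤+ z≤n

if-⟦⟧≡⟦∧⟧ : ∀ c y → (if c then ⟦ y ⟧ else 0ℤ) ≡ ⟦ c ∧ y ⟧
if-⟦⟧≡⟦∧⟧ true  y = refl
if-⟦⟧≡⟦∧⟧ false y = refl

∧≡true⇔ : ∀ {a b} → (a ∧ b ≡ true) ⇔ (a ≡ true × b ≡ true)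
∧≡true⇔ {a} {b} = mk⇔ (split a b) λ { (refl , refl) → refl }
  where
  split : ∀ a b → a ∧ b ≡ true → a ≡ true × b ≡ true
  split true true refl = refl , refl

not-does≡true⇔ : ∀ {p} {P : Set p} (P? : Dec P) → (not (does P?) ≡ true) ⇔ (¬ P)
not-does≡true⇔ (yes p) = mk⇔ (λ ()) (λ ¬p → contradiction p ¬p)
not-does≡true⇔ (no ¬p) = mk⇔ (λ _ → ¬p) (λ _ → refl)

Σ-cong : ∀ {n} {f g : Fin n → ℤ} → (∀ i → f i ≡ g i) → Σ f ≡ Σ g
Σ-cong {zero}  f≗g = refl
Σ-cong {suc n} f≗g = cong₂ _+_ (f≗g zero) (Σ-cong (f≗g ∘ suc))

Σ⟦⟧-nonneg : ∀ {n} (b : Fin n → Bool) → 0ℤ ≤ Σ (λ i → ⟦ b i ⟧)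
Σ⟦⟧-nonneg {zero}  b = ≤-refl
Σ⟦⟧-nonneg {suc n} b = +-mono-≤ (⟦⟧-nonneg (b zero)) (Σ⟦⟧-nonneg (b ∘ suc))

Σ⟦⟧-positive⇔∃ : ∀ {n} (b : Fin n → Bool) → (1ℤ ≤ Σ (λ i → ⟦ b i ⟧)) ⇔ (∃ λ i → b i ≡ true)
Σ⟦⟧-positive⇔∃ b = mk⇔ (witness b) (positive b)
  where
  witness : ∀ {n} (b : Fin n → Bool) → 1ℤ ≤ Σ (λ i → ⟦ b i ⟧) → ∃ λ i → b i ≡ true
  witness {zero}  b (+≤+ ())
  witness {suc n} b 1≤Σ with b zero in b₀≡true
  ... | true  = zero , b₀≡true
  ... | false =
    let i , bᵢ≡true = witness (b ∘ suc) (subst (1ℤ ≤_) (+-identityˡ _) 1≤Σ)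
    in suc i , bᵢ≡true
  positive : ∀ {n} (b : Fin n → Bool) → (∃ λ i → b i ≡ true) → 1ℤ ≤ Σ (λ i → ⟦ b i ⟧)
  positive b (zero , b₀≡true) rewrite b₀≡true = +-monoʳ-≤ 1ℤ (Σ⟦⟧-nonneg (b ∘ suc))
  positive b (suc i , bᵢ≡true) =
    +-mono-≤ (⟦⟧-nonneg (b zero)) (positive (b ∘ suc) (i , bᵢ≡true))

Adj-sym : ∀ {n} (G : SimpleGraph n) {u v} → Adj G u v → Adj G v u
Adj-sym G {u} {v} uv = trans (adj-sym G v u) uv

OtherNbrIn : ∀ {n} → SimpleGraph n → (Fin n → Bool) → Fin n → Fin n → Set
OtherNbrIn G x u v = ∃ λ w → Adj G u w × w ≢ v × InF x w

module _ {n} (G : SimpleGraph n) (x : Fin n → Bool) (u v : Fin n) where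

  otherNbr : Fin n → Bool
  otherNbr w = (adj G u w ∧ not (does (w ≟ v))) ∧ x w

  otherNbr≡true⇔ : ∀ w → (otherNbr w ≡ true) ⇔ (Adj G u w × w ≢ v × InF x w)
  otherNbr≡true⇔ w = mk⇔
    (λ e → let uw∧w≢v , w∈F = to ∧≡true⇔ e
               uw , w≢v     = to ∧≡true⇔ uw∧w≢v
           in uw , to (not-does≡true⇔ (w ≟ v)) w≢v , w∈F)
    (λ (uw , w≢v , w∈F) → from ∧≡true⇔ (from ∧≡true⇔ (uw , from (not-does≡true⇔ (w ≟ v)) w≢v) , w∈F))

  nbrSumExcept≡Σ⟦otherNbr⟧ : nbrSumExcept G x u v ≡ Σ (λ w → ⟦ otherNbr w ⟧)
  nbrSumExcept≡Σ⟦otherNbr⟧ = Σ-cong (λ w → if-⟦⟧≡⟦∧⟧ (adj G u w ∧ not (does (w ≟ v))) (x w))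

  nbrSumExcept-nonneg : 0ℤ ≤ nbrSumExcept G x u v
  nbrSumExcept-nonneg = subst (0ℤ ≤_) (sym nbrSumExcept≡Σ⟦otherNbr⟧) (Σ⟦⟧-nonneg otherNbr)

  nbrSumExcept-positive⇔OtherNbrIn : (1ℤ ≤ nbrSumExcept G x u v) ⇔ OtherNbrIn G x u v
  nbrSumExcept-positive⇔OtherNbrIn = mk⇔
    (λ 1≤s → let w , e = to (Σ⟦⟧-positive⇔∃ otherNbr) (subst (1ℤ ≤_) nbrSumExcept≡Σ⟦otherNbr⟧ 1≤s)
             in w , to (otherNbr≡true⇔ w) e)
    (λ (w , h) → subst (1ℤ ≤_) (sym nbrSumExcept≡Σ⟦otherNbr⟧)
                   (from (Σ⟦⟧-positive⇔∃ otherNbr) (w , from (otherNbr≡true⇔ w) h)))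

  otherNbrIn? : Dec (OtherNbrIn G x u v)
  otherNbrIn? = Dec.map nbrSumExcept-positive⇔OtherNbrIn (1ℤ ≤? nbrSumExcept G x u v)

0≤⟦a⟧-⟦b⟧+s⇔ : ∀ a b {s} → 0ℤ ≤ s → (0ℤ ≤ (⟦ a ⟧ - ⟦ b ⟧) + s) ⇔ (a ≢ true → b ≡ true → 1ℤ ≤ s)
0≤⟦a⟧-⟦b⟧+s⇔ true  true  0≤s = mk⇔ (λ _ a≢true → contradiction refl a≢true) (λ _ → +-monoʳ-≤ 0ℤ 0≤s)
0≤⟦a⟧-⟦b⟧+s⇔ true  false 0≤s = mk⇔ (λ _ a≢true → contradiction refl a≢true) (λ _ → +-mono-≤ (+≤+ z≤n) 0≤s)
0≤⟦a⟧-⟦b⟧+s⇔ false false 0≤s = mk⇔ (λ _ _ ()) (λ _ → +-monoʳ-≤ 0ℤ 0≤s)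
0≤⟦a⟧-⟦b⟧+s⇔ false true  0≤s = mk⇔
  -- (⟦ false ⟧ - ⟦ true ⟧) + s reduces to pred s
  (λ 0≤pred[s] _ _ → i<j⇒suc[i]≤j (i≤pred[j]⇒i<j 0≤pred[s]))
  (λ 1≤s → i<j⇒i≤pred[j] (suc[i]≤j⇒i<j (1≤s (λ ()) refl)))

fortInequality⇔ : ∀ {n} (G : SimpleGraph n) x u v →
  ((⟦ x u ⟧ - ⟦ x v ⟧) + nbrSumExcept G x u v ≥ 0ℤ) ⇔ (¬ InF x u → InF x v → OtherNbrIn G x u v)
fortInequality⇔ G x u v = mk⇔
  (λ ineq u∉F v∈F → to (nbrSumExcept-positive⇔OtherNbrIn G x u v) (to ineq⇔ ineq u∉F v∈F))
  (λ other → from ineq⇔ (λ u∉F v∈F → from (nbrSumExcept-positive⇔OtherNbrIn G x u v) (other u∉F v∈F)))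
  where
  ineq⇔ = 0≤⟦a⟧-⟦b⟧+s⇔ (x u) (x v) (nbrSumExcept-nonneg G x u v)

¬ExactlyOneNbrIn⇔ : ∀ {n} (G : SimpleGraph n) x u →
  (¬ ExactlyOneNbrIn G x u) ⇔ (∀ v → Adj G u v → InF x v → OtherNbrIn G x u v)
¬ExactlyOneNbrIn⇔ G x u = mk⇔ otherNbr-exists noUniqueNbr
  where
  otherNbr-exists : ¬ ExactlyOneNbrIn G x u → ∀ v → Adj G u v → InF x v → OtherNbrIn G x u v
  otherNbr-exists ¬one v uv v∈F with otherNbrIn? G x u v
  ... | yes other = other
  ... | no ¬other = contradiction (v , uv , v∈F , unique) ¬one
    where
    unique : ∀ w → Adj G u w → InF x w → w ≡ v
    unique w uw w∈F = decidable-stable (w ≟ v) (λ w≢v → ¬other (w , uw , w≢v , w∈F))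
  noUniqueNbr : (∀ v → Adj G u v → InF x v → OtherNbrIn G x u v) → ¬ ExactlyOneNbrIn G x u
  noUniqueNbr other (v , uv , v∈F , unique) =
    let w , uw , w≢v , w∈F = other v uv v∈F in w≢v (unique w uw w∈F)

isFort⇔ : ∀ {n} (G : SimpleGraph n) x →
  IsFort G x ⇔
  ((Σ (λ v → ⟦ x v ⟧) ≥ 1ℤ) ×
   (∀ v u → Adj G v u → (⟦ x u ⟧ - ⟦ x v ⟧) + nbrSumExcept G x u v ≥ 0ℤ))
isFort⇔ G x = mk⇔
  (λ (nonempty , noExactlyOne) →
     from (Σ⟦⟧-positive⇔∃ x) nonempty ,
     λ v u vu → from (fortInequality⇔ G x u v) λ u∉F v∈F →
       to (¬ExactlyOneNbrIn⇔ G x u) (noExactlyOne u u∉F) v (Adj-sym G vu) v∈F)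
  (λ (Σ≥1 , ineqs) →
     to (Σ⟦⟧-positive⇔∃ x) Σ≥1 ,
     λ u u∉F → from (¬ExactlyOneNbrIn⇔ G x u) λ v uv v∈F →
       to (fortInequality⇔ G x u v) (ineqs v u (Adj-sym G uv)) u∉F v∈F)

closure-disjoint-fort : ∀ {n} {G : SimpleGraph n} {C : Subset n} {x : Fin n → Bool} →
  (∀ u → ¬ InF x u → ¬ ExactlyOneNbrIn G x u) → (∀ v → v ∈ C → ¬ InF x v) →
  ∀ {v} → InClosure G C v → ¬ InF x v
closure-disjoint-fort closed C∩F≡∅ (base v∈C) = C∩F≡∅ _ v∈C
closure-disjoint-fort {x = x} closed C∩F≡∅ (force {u} {v} u∈cl uv rest) v∈F =
  closed u (outside u∈cl) (v , uv , v∈F , λ w uw w∈F →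
    decidable-stable (w ≟ v) (λ w≢v → outside (rest w uw w≢v) w∈F))
  where
  outside : ∀ {w} → InClosure _ _ w → ¬ InF x w
  outside = closure-disjoint-fort closed C∩F≡∅

theorem5p3 : ∀ {n : ℕ} (G : SimpleGraph n) (C : Subset n) (x : Fin n → Bool) →
    (IsFort G x × (∀ v → InF x v → ¬ InClosure G C v))
    ⇔
    ((Σ (λ v → ⟦ x v ⟧) ≥ 1ℤ) ×
     (∀ v u → Adj G v u → (⟦ x u ⟧ - ⟦ x v ⟧) + nbrSumExcept G x u v ≥ 0ℤ) ×
     (∀ v → v ∈ C → x v ≡ false))
theorem5p3 G C x = mk⇔
  (λ (fort , F∩cl≡∅) →
     let Σ≥1 , ineqs = to (isFort⇔ G x) fort
     in Σ≥1 , ineqs , λ v v∈C → ¬-not (λ v∈F → F∩cl≡∅ v v∈F (base v∈C)))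
  (λ (Σ≥1 , ineqs , C∩F≡∅) →
     let fort = from (isFort⇔ G x) (Σ≥1 , ineqs)
     in fort , λ v v∈F v∈cl →
          closure-disjoint-fort (proj₂ fort) (λ w w∈C → not-¬ (C∩F≡∅ w w∈C)) v∈cl v∈F)
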